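{- Let $(S,*)$ be a commutative adequate partial semigroup, let $A\subseteq S$, and let $k\in\mathbb{N}$. The following are equivalent. (1) For every $L\in\mathcal{P}_f(S)$ there exists $r\in\mathbb{N}$ such that for every $F\in\mathcal{P}_f(\mathcal{T})_{\leq k}$ there exist $b\in S$ and $H\in\mathcal{P}_f(\{1,\dots,r\})$ such that for all $f\in F$, $b*\prod_{t\in H}f(t)$ is defined and lies in $A\cap\sigma(L)$. (2) For every $L\in\mathcal{P}_f(S)$ there exists $r\in\mathbb{N}$ such that for every $F\in\mathcal{P}_f(\mathcal{T})_{\leq k}$ there exist $m\in\mathbb{N}$, $a\in S^{m+1}$ and $t(1)<\dots<t(m)\leq r$ in $\mathbb{N}$ such that for all $f\in F$, $a(1)*f(t(1))*a(2)*\dots*a(m)*f(t(m))*a(m+1)$ is defined and lies in $A\cap\sigma(L)$.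
   Context: A partial semigroup is a pair $(S,*)$ where $S$ is a nonempty set and $*$ is an operation defined on a nonempty subset of $S\times S$ such that for all $x,y,z\in S$, $(x*y)*z=x*(y*z)$ in the sense that if either side is defined then so is the other and they are equal; it is commutative if for all $x,y$, $x*y$ is defined iff $y*x$ is defined, and then $x*y=y*x$. For $a\in S$, $\varphi(a)=\{b\in S: a*b \text{ is defined}\}$; for finite nonempty $F\subseteq S$, $\sigma(F)=\bigcap_{a\in F}\varphi(a)$. $(S,*)$ is adequate if $\sigma(F)\neq\emptyset$ for all finite nonempty $F$. $\mathcal{P}_f(X)$ denotes the set of finite nonempty subsets of $X$. Products $\prod_{t\in H}f(t)$ are computed in increasing order of indices. A sequence $f:\mathbb{N}\to S$ is adequate if (i) for each $H\in\mathcal{P}_f(\mathbb{N})$, $\prod_{t\in H}f(t)$ is defined, and (ii) for each $F\in\mathcal{P}_f(S)$ there is $m\in\mathbb{N}$ such that $\prod_{t\in H}f(t)\in\sigma(F)$ for all $H\in\mathcal{P}_f(\mathbb{N})$ with $\min H\geq m$. $\mathcal{T}$ denotes the set of adequate sequences, and $\mathcal{P}_f(\mathcal{T})_{\leq k}=\{F\in\mathcal{P}_f(\mathcal{T}): |F|\leq k\}$. -}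

module Defs where

open import Data.Nat using (ℕ; zero; suc; _≤_; _<_)
open import Data.Maybe using (Maybe; just; nothing; _>>=_; Is-just)
open import Data.Product using (Σ; ∃; _×_; _,_; proj₁)
open import Data.List using (List; []; _∷_)
open import Data.List.NonEmpty using (List⁺; toList)
open import Data.List.Relation.Unary.All using (All)
open import Data.List.Relation.Unary.AllPairs using (AllPairs)
open import Data.Fin as Fin using (Fin)
open import Relation.Binary.PropositionalEquality using (_≡_)

-- A partial semigroup: the partial operation is modelled as a total
-- function into Maybe; 'nothing' means "undefined".
record PartialSemigroup : Set₁ where
  field
    Carrier  : Set
    _*_      : Carrier → Carrier → Maybe Carrier
    inhabitant : Carrier
    someDefined : Σ Carrier λ x → Σ Carrier λ y → Is-just (x * y)
    -- (x*y)*z = x*(y*z): either side defined iff the other is, and then equal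
    assoc    : ∀ x y z → ((x * y) >>= λ u → u * z) ≡ ((y * z) >>= λ v → x * v)

module PS (P : PartialSemigroup) where
  open PartialSemigroup P public

  _⊛_ : Maybe Carrier → Maybe Carrier → Maybe Carrier
  m ⊛ n = m >>= λ x → n >>= λ y → x * y

  Commutative : Set
  Commutative = ∀ x y → x * y ≡ y * x

  φ : Carrier → Carrier → Set
  φ a b = Is-just (a * b)

  σ : List⁺ Carrier → Carrier → Set
  σ F b = All (λ a → φ a b) (toList F)

  Adequate : Set
  Adequate = (F : List⁺ Carrier) → Σ Carrier λ b → σ F b

  -- A finite nonempty H ⊆ ℕ is given by its elements in increasing order
  -- h ∷ hs with AllPairs _<_ (h ∷ hs); h = min H.
  -- ∏_{t ∈ H} f(t), computed in increasing order of indices.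
  prod : (ℕ → Carrier) → ℕ → List ℕ → Maybe Carrier
  prod f h []       = just (f h)
  prod f h (x ∷ xs) = just (f h) ⊛ prod f x xs

  DefinedIn : (Carrier → Set) → Maybe Carrier → Set
  DefinedIn X mv = Σ Carrier λ c → mv ≡ just c × X c

  IsAdequateSeq : (ℕ → Carrier) → Set
  IsAdequateSeq f =
    ((h : ℕ) (hs : List ℕ) → AllPairs _<_ (h ∷ hs) → Is-just (prod f h hs))
    × ((F : List⁺ Carrier) → Σ ℕ λ m →
         (h : ℕ) (hs : List ℕ) → AllPairs _<_ (h ∷ hs) → m ≤ h →
         DefinedIn (σ F) (prod f h hs))

  AdequateSeq : Set
  AdequateSeq = Σ (ℕ → Carrier) IsAdequateSeq

  -- a(1) * f(t(1)) * a(2) * ... * a(m) * f(t(m)) * a(m+1)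
  -- (here indices of a and t are Fin-indexed, starting at 0)
  interleave : (ℕ → Carrier) → (m : ℕ) → (Fin (suc m) → Carrier) → (Fin m → ℕ) → Maybe Carrier
  interleave f zero    a t = just (a Fin.zero)
  interleave f (suc m) a t =
    just (a Fin.zero) ⊛ (just (f (t Fin.zero)) ⊛ interleave f m (λ i → a (Fin.suc i)) (λ i → t (Fin.suc i)))

{-# OPTIONS --safe #-}
-- (2) ⇒ (1): by commutativity an interleaved product a(1) f(t(1)) a(2) ⋯ f(t(m)) a(m+1) equals
-- b ∏_{t∈H} f(t) with b = a(1) ⋯ a(m+1) and H = {t(1), …, t(m)}.
-- (1) ⇒ (2): for the given F, adequacy of S lets us choose c(0), c(1), … one at a time so that
-- ∏_{i<r} f(i) c(i) is defined for every f ∈ F.  Replace each f by the sequence g that equals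
-- f·c below r and a far-out tail of f from r on; the tail is chosen so that its products are
-- compatible with ∏_{i<r} f(i) c(i), which makes g adequate again.  Property (1) for these g
-- gives b and H ⊆ {0, …, r-1}, and b ∏_{t∈H} f(t) c(t) is an interleaved product with
-- a = (b, c(t(1)), …, c(t(m))).
module Submission where

open import Defs
open import Algebra.Bundles using (CommutativeMonoid)
open import Algebra.Structures using (IsCommutativeMonoid)
open import Data.Fin as Fin using (Fin)
open import Data.List using (List; []; _∷_; _++_; map; foldr; filter; reverse; upTo; applyUpTo; downFrom; tabulate; lookup; length; allFin)
open import Data.List.Membership.Propositional.Properties using (∈-lookup)
open import Data.List.NonEmpty as List⁺ using (List⁺; toList)
open import Data.List.Properties using (map-++; map-tabulate; tabulate-lookup; unfold-reverse; reverse-downFrom; length-map)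
open import Data.List.Relation.Binary.Permutation.Propositional using (_↭_; ↭-refl; ↭-sym; ↭-trans; prep; ↭⇒↭ₛ)
open import Data.List.Relation.Binary.Permutation.Propositional.Properties using (↭-reverse; shift; All-resp-↭)
import Data.List.Relation.Binary.Permutation.Propositional.Properties as ↭
import Data.List.Relation.Binary.Permutation.Setoid.Properties as Setoid↭
open import Data.List.Relation.Binary.Sublist.Propositional using (_⊆_; []; _∷_; _∷ʳ_; minimum)
open import Data.List.Relation.Unary.All as All using (All; []; _∷_)
import Data.List.Relation.Unary.All.Properties as All
open import Data.List.Relation.Unary.AllPairs as AllPairs using (AllPairs; []; _∷_)
import Data.List.Relation.Unary.AllPairs.Properties as AllPairs
open import Data.Maybe using (Maybe; just; nothing; Is-just)
open import Data.Maybe.Properties using (just-injective)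
open import Data.Maybe.Relation.Unary.Any using () renaming (just to is-just)
open import Data.Nat using (ℕ; zero; suc; _+_; _≤_; _<_; _>_; z≤n; s≤s; s≤s⁻¹; _<?_; _≟_)
open import Data.Nat.Properties using (<-trans; ≤∧≢⇒<; +-monoˡ-<; m≤n+m; m≤m+n; ≤-trans; ≮⇒≥; <⇒≤; <⇒≱)
open import Data.Product using (Σ; ∃; _×_; _,_; proj₁; proj₂)
open import Data.Unit using (⊤; tt)
open import Data.Vec.Functional as Vector using ()
open import Function using (_∘_; id)
open import Function.Bundles using (_⇔_; mk⇔)
open import Relation.Binary.PropositionalEquality
open import Relation.Nullary using (yes; no; Dec; contradiction)
open import Relation.Unary.Properties using (∁?)

decreasing⊆downFrom : ∀ {l} n → AllPairs _>_ l → All (_< n) l → l ⊆ downFrom n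
decreasing⊆downFrom {[]}    n       _            _            = minimum (downFrom n)
decreasing⊆downFrom {x ∷ _} zero    _            (() ∷ _)
decreasing⊆downFrom {x ∷ _} (suc n) (x>xs ∷ xs↓) (x<1+n ∷ xs<) with x ≟ n
... | yes refl = refl ∷ decreasing⊆downFrom n xs↓ x>xs
... | no x≢n   = n ∷ʳ decreasing⊆downFrom n (x>xs ∷ xs↓) (x<n ∷ All.map (λ y<x → <-trans y<x x<n) x>xs)
  where
  x<n : x < n
  x<n = ≤∧≢⇒< (s≤s⁻¹ x<1+n) x≢n

reverse-increasing : ∀ {l} → AllPairs _<_ l → AllPairs _>_ (reverse l)
reverse-increasing {[]}     []           = []
reverse-increasing {x ∷ xs} (x<xs ∷ xs↑) rewrite unfold-reverse x xs =
  AllPairs.++⁺ (reverse-increasing xs↑) ([] ∷ [])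
    (All-resp-↭ (↭-sym (↭-reverse xs)) (All.map (_∷ []) x<xs))

lookup-increasing : ∀ {l} → AllPairs _<_ l → ∀ {i j} → i Fin.< j → lookup l i < lookup l j
lookup-increasing {_ ∷ _} (x<l ∷ _) {Fin.zero}  {Fin.suc j} _         = All.lookup x<l (∈-lookup j)
lookup-increasing {_ ∷ _} (_ ∷ l↑)  {Fin.suc i} {Fin.suc j} (s≤s i<j) = lookup-increasing l↑ i<j

⊆⇒↭-++ : ∀ {A : Set} {xs ys : List A} → xs ⊆ ys → ∃ λ zs → ys ↭ xs ++ zs
⊆⇒↭-++ []             = [] , ↭-refl
⊆⇒↭-++ (y ∷ʳ xs⊆ys)   with zs , p ← ⊆⇒↭-++ xs⊆ys = y ∷ zs , ↭-trans (prep y p) (↭-sym (shift y _ zs))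
⊆⇒↭-++ (refl ∷ xs⊆ys) with zs , p ← ⊆⇒↭-++ xs⊆ys = zs , prep _ p

module _ (P : PartialSemigroup) where
  open PS P

  PrefixedProductsIn : (Carrier → Set) → ℕ → List⁺ AdequateSeq → Set
  PrefixedProductsIn X r F =
    Σ Carrier λ b → Σ ℕ λ h → Σ (List ℕ) λ hs → AllPairs _<_ (h ∷ hs) × All (_< r) (h ∷ hs) ×
      All (λ f → DefinedIn X (just b ⊛ prod (proj₁ f) h hs)) (toList F)

  InterleavedProductsIn : (Carrier → Set) → ℕ → List⁺ AdequateSeq → Set
  InterleavedProductsIn X r F =
    Σ ℕ λ m → 1 ≤ m × Σ (Fin (suc m) → Carrier) λ a → Σ (Fin m → ℕ) λ t →
      ((i j : Fin m) → i Fin.< j → t i < t j) × ((i : Fin m) → t i < r) ×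
      All (λ f → DefinedIn X (interleave (proj₁ f) m a t)) (toList F)

  ⊛-assoc : ∀ m n o → (m ⊛ n) ⊛ o ≡ m ⊛ (n ⊛ o)
  ⊛-assoc nothing  _        _        = refl
  ⊛-assoc (just _) nothing  _        = refl
  ⊛-assoc (just x) (just y) nothing  with x * y
  ... | nothing = refl
  ... | just _  = refl
  ⊛-assoc (just x) (just y) (just z) = assoc x y z

  -- Maybe Carrier with _⊛_ is S with a zero ('nothing', "undefined") adjoined; S¹ adjoins
  -- an identity ε on top of that, so that products of finitely many elements are total.
  S¹ : Set
  S¹ = Maybe (Maybe Carrier)

  ε : S¹
  ε = nothing

  infixl 6 _∙_
  _∙_ : S¹ → S¹ → S¹
  nothing ∙ y       = y
  just x  ∙ nothing = just x
  just x  ∙ just y  = just (x ⊛ y)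

  ⟦_⟧ : Carrier → S¹
  ⟦ x ⟧ = just (just x)

  ∙-assoc : ∀ x y z → (x ∙ y) ∙ z ≡ x ∙ (y ∙ z)
  ∙-assoc nothing  _        _        = refl
  ∙-assoc (just _) nothing  _        = refl
  ∙-assoc (just _) (just _) nothing  = refl
  ∙-assoc (just a) (just b) (just c) = cong just (⊛-assoc a b c)

  ∙-identityʳ : ∀ x → x ∙ ε ≡ x
  ∙-identityʳ nothing  = refl
  ∙-identityʳ (just _) = refl

  Defined : S¹ → Set
  Defined nothing  = ⊤
  Defined (just m) = Is-just m

  Defined? : ∀ x → Dec (Defined x)
  Defined? nothing         = yes tt
  Defined? (just nothing)  = no λ ()
  Defined? (just (just _)) = yes (is-just tt)

  Defined-∙ˡ : ∀ x {y} → Defined (x ∙ y) → Defined x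
  Defined-∙ˡ nothing         _ = tt
  Defined-∙ˡ (just nothing)  {nothing} ()
  Defined-∙ˡ (just nothing)  {just _}  ()
  Defined-∙ˡ (just (just _)) _ = is-just tt

  -- The value at ε and at undefined elements is junk.
  value : S¹ → Carrier
  value (just (just x)) = x
  value _               = inhabitant

  ⟦value⟧ : ∀ {m} → Is-just m → ⟦ value (just m) ⟧ ≡ just m
  ⟦value⟧ (is-just _) = refl

  Defined-∙⟦⟧ : ∀ x {y} → Defined x → φ (value x) y → Defined (x ∙ ⟦ y ⟧)
  Defined-∙⟦⟧ nothing         _ _   = is-just tt
  Defined-∙⟦⟧ (just (just _)) _ xy↓ = xy↓

  ⟦⟧∙-value : ∀ x y → Defined (⟦ x ⟧ ∙ y) → ⟦ x ⟧ ∙ y ≡ ⟦ value (⟦ x ⟧ ∙ y) ⟧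
  ⟦⟧∙-value x nothing         _   = refl
  ⟦⟧∙-value x (just (just y)) xy↓ = sym (⟦value⟧ xy↓)

  Π : List S¹ → S¹
  Π = foldr _∙_ ε

  ∏ : ∀ {A : Set} → (A → S¹) → List A → S¹
  ∏ G xs = Π (map G xs)

  Π-++ : ∀ xs ys → Π (xs ++ ys) ≡ Π xs ∙ Π ys
  Π-++ []       ys = refl
  Π-++ (x ∷ xs) ys = trans (cong (x ∙_) (Π-++ xs ys)) (sym (∙-assoc x (Π xs) (Π ys)))

  ∏-cong : ∀ {A : Set} {G H : A → S¹} {xs} → All (λ x → G x ≡ H x) xs → ∏ G xs ≡ ∏ H xs
  ∏-cong []            = refl
  ∏-cong (Gx≡Hx ∷ eqs) = cong₂ _∙_ Gx≡Hx (∏-cong eqs)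

  prod-∏ : ∀ f h hs → just (prod f h hs) ≡ ∏ (⟦_⟧ ∘ f) (h ∷ hs)
  prod-∏ f h []       = refl
  prod-∏ f h (x ∷ xs) = cong (⟦ f h ⟧ ∙_) (prod-∏ f x xs)

  interleave-∏ : ∀ f m a t →
    just (interleave f m a t) ≡ ⟦ a Fin.zero ⟧ ∙ Π (tabulate (λ i → ⟦ f (t i) ⟧ ∙ ⟦ a (Fin.suc i) ⟧))
  interleave-∏ f zero    a t = refl
  interleave-∏ f (suc m) a t = begin
    just (interleave f (suc m) a t)           ≡⟨ cong (λ z → a₀ ∙ (⟦ f (t Fin.zero) ⟧ ∙ z)) (interleave-∏ f m (a ∘ Fin.suc) (t ∘ Fin.suc)) ⟩
    a₀ ∙ (⟦ f (t Fin.zero) ⟧ ∙ (a₁ ∙ rest))   ≡⟨ cong (a₀ ∙_) (∙-assoc ⟦ f (t Fin.zero) ⟧ a₁ rest) ⟨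
    a₀ ∙ (⟦ f (t Fin.zero) ⟧ ∙ a₁ ∙ rest)     ∎
    where
    open ≡-Reasoning
    a₀ a₁ rest : S¹
    a₀ = ⟦ a Fin.zero ⟧
    a₁ = ⟦ a (Fin.suc Fin.zero) ⟧
    rest = Π (tabulate (λ i → ⟦ f (t (Fin.suc i)) ⟧ ∙ ⟦ a (Fin.suc (Fin.suc i)) ⟧))

  interleave-lookup : ∀ f b c H →
    just (interleave f (length H) (b Vector.∷ (c ∘ lookup H)) (lookup H)) ≡ ⟦ b ⟧ ∙ ∏ (λ i → ⟦ f i ⟧ ∙ ⟦ c i ⟧) H
  interleave-lookup f b c H = begin
    just (interleave f (length H) (b Vector.∷ (c ∘ lookup H)) (lookup H))  ≡⟨ interleave-∏ f (length H) _ (lookup H) ⟩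
    ⟦ b ⟧ ∙ Π (tabulate (fc ∘ lookup H))                                   ≡⟨ cong (λ l → ⟦ b ⟧ ∙ Π l) (map-tabulate (lookup H) fc) ⟨
    ⟦ b ⟧ ∙ ∏ fc (tabulate (lookup H))                                     ≡⟨ cong (λ l → ⟦ b ⟧ ∙ ∏ fc l) (tabulate-lookup H) ⟩
    ⟦ b ⟧ ∙ ∏ fc H                                                         ∎
    where
    open ≡-Reasoning
    fc : ℕ → S¹
    fc i = ⟦ f i ⟧ ∙ ⟦ c i ⟧

  module _ (comm : Commutative) where

    ⊛-comm : ∀ m n → m ⊛ n ≡ n ⊛ m
    ⊛-comm nothing  nothing  = refl
    ⊛-comm nothing  (just _) = refl
    ⊛-comm (just _) nothing  = refl
    ⊛-comm (just x) (just y) = comm x y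

    ∙-comm : ∀ x y → x ∙ y ≡ y ∙ x
    ∙-comm nothing  nothing  = refl
    ∙-comm nothing  (just _) = refl
    ∙-comm (just _) nothing  = refl
    ∙-comm (just a) (just b) = cong just (⊛-comm a b)

    ∙-isCommutativeMonoid : IsCommutativeMonoid _≡_ _∙_ ε
    ∙-isCommutativeMonoid = record
      { isMonoid = record
        { isSemigroup = record
          { isMagma = record { isEquivalence = isEquivalence ; ∙-cong = cong₂ _∙_ }
          ; assoc   = ∙-assoc }
        ; identity = (λ _ → refl) , ∙-identityʳ }
      ; comm = ∙-comm }

    ∙-commutativeMonoid : CommutativeMonoid _ _
    ∙-commutativeMonoid = record { isCommutativeMonoid = ∙-isCommutativeMonoid }

    open import Algebra.Properties.CommutativeSemigroup (CommutativeMonoid.commutativeSemigroup ∙-commutativeMonoid)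
      using (interchange; x∙yz≈y∙xz; x∙yz≈xz∙y; xy∙z≈xz∙y; xy∙z≈x∙zy)

    ∏-↭ : ∀ {A : Set} (G : A → S¹) {xs ys} → xs ↭ ys → ∏ G xs ≡ ∏ G ys
    ∏-↭ G xs↭ys = Setoid↭.foldr-commMonoid (setoid S¹) ∙-isCommutativeMonoid (↭⇒↭ₛ (↭.map⁺ G xs↭ys))

    ∏-∙ : ∀ {A : Set} (G H : A → S¹) xs → ∏ (λ x → G x ∙ H x) xs ≡ ∏ G xs ∙ ∏ H xs
    ∏-∙ G H []       = refl
    ∏-∙ G H (x ∷ xs) = trans (cong (G x ∙ H x ∙_) (∏-∙ G H xs)) (interchange (G x) (H x) (∏ G xs) (∏ H xs))

    ∏-partition : ∀ {A : Set} (G : A → S¹) {Q : A → Set} (Q? : ∀ x → Dec (Q x)) xs →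
      ∏ G xs ≡ ∏ G (filter Q? xs) ∙ ∏ G (filter (∁? Q?) xs)
    ∏-partition G Q? []       = refl
    ∏-partition G Q? (x ∷ xs) with Q? x
    ... | yes _ = trans (cong (G x ∙_) (∏-partition G Q? xs)) (sym (∙-assoc (G x) (∏ G (filter Q? xs)) (∏ G (filter (∁? Q?) xs))))
    ... | no _  = trans (cong (G x ∙_) (∏-partition G Q? xs)) (x∙yz≈y∙xz (G x) (∏ G (filter Q? xs)) (∏ G (filter (∁? Q?) xs)))

    Defined-∏-⊆ : ∀ {A : Set} (G : A → S¹) {xs ys} Y → xs ⊆ ys → Defined (∏ G ys ∙ Y) → Defined (∏ G xs ∙ Y)
    Defined-∏-⊆ G {xs} {ys} Y xs⊆ys ys↓ with zs , ys↭ ← ⊆⇒↭-++ xs⊆ys =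
      Defined-∙ˡ (∏ G xs ∙ Y) (subst Defined ∏ys∙Y≡ ys↓)
      where
      ∏ys∙Y≡ : ∏ G ys ∙ Y ≡ ∏ G xs ∙ Y ∙ ∏ G zs
      ∏ys∙Y≡ = begin
        ∏ G ys ∙ Y                    ≡⟨ cong (_∙ Y) (∏-↭ G ys↭) ⟩
        Π (map G (xs ++ zs)) ∙ Y      ≡⟨ cong (λ l → Π l ∙ Y) (map-++ G xs zs) ⟩
        Π (map G xs ++ map G zs) ∙ Y  ≡⟨ cong (_∙ Y) (Π-++ (map G xs) (map G zs)) ⟩
        ∏ G xs ∙ ∏ G zs ∙ Y           ≡⟨ xy∙z≈xz∙y (∏ G xs) (∏ G zs) Y ⟩
        ∏ G xs ∙ Y ∙ ∏ G zs           ∎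
        where open ≡-Reasoning

    Defined-∏-increasing : ∀ (G : ℕ → S¹) {l r} Y → AllPairs _<_ l → All (_< r) l →
      Defined (∏ G (downFrom r) ∙ Y) → Defined (∏ G l ∙ Y)
    Defined-∏-increasing G {l} {r} Y l↑ l<r full↓ =
      subst (λ z → Defined (z ∙ Y)) (∏-↭ G (↭-reverse l))
        (Defined-∏-⊆ G Y (decreasing⊆downFrom r (reverse-increasing l↑) (All-resp-↭ (↭-sym (↭-reverse l)) l<r)) full↓)

    adequate-∏-downFrom : ∀ {f} → IsAdequateSeq f → ∀ n → Defined (∏ (⟦_⟧ ∘ f) (downFrom n))
    adequate-∏-downFrom _                    zero    = tt
    adequate-∏-downFrom {f} (f-products , _) (suc n) =
      subst Defined (trans (prod-∏ f 0 (applyUpTo suc n)) (∏-↭ (⟦_⟧ ∘ f) upTo↭downFrom))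
        (f-products 0 (applyUpTo suc n) (AllPairs.applyUpTo⁺₁ id (suc n) (λ i<j _ → i<j)))
      where
      upTo↭downFrom : upTo (suc n) ↭ downFrom (suc n)
      upTo↭downFrom = subst (_↭ downFrom (suc n)) (reverse-downFrom (suc n)) (↭-reverse (downFrom (suc n)))

    interleave-split : ∀ f m a t →
      just (interleave f m a t) ≡ (⟦ a Fin.zero ⟧ ∙ ∏ (⟦_⟧ ∘ a ∘ Fin.suc) (allFin m)) ∙ ∏ (⟦_⟧ ∘ f) (tabulate t)
    interleave-split f m a t = begin
      just (interleave f m a t)                         ≡⟨ interleave-∏ f m a t ⟩
      a₀ ∙ Π (tabulate (λ i → F i ∙ A i))               ≡⟨ cong (λ l → a₀ ∙ Π l) (map-tabulate id (λ i → F i ∙ A i)) ⟨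
      a₀ ∙ ∏ (λ i → F i ∙ A i) (allFin m)               ≡⟨ cong (a₀ ∙_) (∏-∙ F A (allFin m)) ⟩
      a₀ ∙ (∏ F (allFin m) ∙ ∏ A (allFin m))            ≡⟨ x∙yz≈xz∙y a₀ (∏ F (allFin m)) (∏ A (allFin m)) ⟩
      (a₀ ∙ ∏ A (allFin m)) ∙ ∏ F (allFin m)            ≡⟨ cong (λ l → (a₀ ∙ ∏ A (allFin m)) ∙ Π l) (map-tabulate id F) ⟩
      (a₀ ∙ ∏ A (allFin m)) ∙ Π (tabulate F)            ≡⟨ cong (λ l → (a₀ ∙ ∏ A (allFin m)) ∙ Π l) (map-tabulate t (⟦_⟧ ∘ f)) ⟨
      (a₀ ∙ ∏ A (allFin m)) ∙ ∏ (⟦_⟧ ∘ f) (tabulate t)  ∎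
      where
      open ≡-Reasoning
      a₀ : S¹
      a₀ = ⟦ a Fin.zero ⟧
      F A : Fin m → S¹
      F = ⟦_⟧ ∘ f ∘ t
      A = ⟦_⟧ ∘ a ∘ Fin.suc

    adequate-complement : Adequate → (xs : List⁺ S¹) → All Defined (toList xs) →
      Σ (ℕ → Carrier) λ c → ∀ n → All (λ x → Defined (x ∙ ∏ (⟦_⟧ ∘ c) (downFrom n))) (toList xs)
    adequate-complement ad xs xs↓ = c , λ n → subst (λ y → All (λ x → Defined (x ∙ y)) (toList xs)) (prefix≡∏ n) (invariant n)
      where
      prefix : ℕ → S¹
      c : ℕ → Carrier
      c n = proj₁ (ad (List⁺.map (λ x → value (x ∙ prefix n)) xs))
      prefix zero    = ε
      prefix (suc n) = ⟦ c n ⟧ ∙ prefix n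

      prefix≡∏ : ∀ n → prefix n ≡ ∏ (⟦_⟧ ∘ c) (downFrom n)
      prefix≡∏ zero    = refl
      prefix≡∏ (suc n) = cong (⟦ c n ⟧ ∙_) (prefix≡∏ n)

      invariant : ∀ n → All (λ x → Defined (x ∙ prefix n)) (toList xs)
      invariant zero    = All.map (λ {x} → subst Defined (sym (∙-identityʳ x))) xs↓
      invariant (suc n) = All.zipWith step (invariant n , All.map⁻ (proj₂ (ad (List⁺.map (λ x → value (x ∙ prefix n)) xs))))
        where
        step : ∀ {x} → Defined (x ∙ prefix n) × φ (value (x ∙ prefix n)) (c n) → Defined (x ∙ prefix (suc n))
        step {x} (x∙p↓ , compatible) =
          subst Defined (xy∙z≈x∙zy x (prefix n) ⟦ c n ⟧) (Defined-∙⟦⟧ (x ∙ prefix n) x∙p↓ compatible)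

    adequate-prefix-product : ∀ {f} → IsAdequateSeq f → (c : ℕ → Carrier) (r : ℕ) →
      Defined (∏ (λ i → ⟦ f i ⟧ ∙ ⟦ c i ⟧) (downFrom r)) →
      Σ (ℕ → Carrier) λ g → IsAdequateSeq g × (∀ {i} → i < r → ⟦ g i ⟧ ≡ ⟦ f i ⟧ ∙ ⟦ c i ⟧)
    adequate-prefix-product {f} (f-products , f-tails) c r full↓ = g , (g-products , g-tails) , g-low
      where
      fc : ℕ → S¹
      fc i = ⟦ f i ⟧ ∙ ⟦ c i ⟧

      full : S¹
      full = ∏ fc (downFrom r)

      full∙ε↓ : Defined (full ∙ ε)
      full∙ε↓ = subst Defined (sym (∙-identityʳ full)) full↓

      -- N is where the products of f become compatible with full; beyond r, g is f shifted by N.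
      N : ℕ
      N = proj₁ (f-tails (value full List⁺.∷ []))

      g : ℕ → Carrier
      g i with i <? r
      ... | yes _ = value (fc i)
      ... | no _  = f (i + N)

      g-low : ∀ {i} → i < r → ⟦ g i ⟧ ≡ fc i
      g-low {i} i<r with i <? r
      ... | yes _   = ⟦value⟧ (Defined-∏-increasing fc ε ([] ∷ []) (i<r ∷ []) full∙ε↓)
      ... | no i≮r  = contradiction i<r i≮r

      g-high : ∀ {i} → r ≤ i → g i ≡ f (i + N)
      g-high {i} r≤i with i <? r
      ... | yes i<r = contradiction r≤i (<⇒≱ i<r)
      ... | no _    = refl

      prod-g-high : ∀ h hs → All (r ≤_) (h ∷ hs) → prod g h hs ≡ prod f (h + N) (map (_+ N) hs)
      prod-g-high h []       (r≤h ∷ [])   = cong just (g-high r≤h)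
      prod-g-high h (x ∷ xs) (r≤h ∷ r≤xs) = cong₂ (λ u v → just u ⊛ v) (g-high r≤h) (prod-g-high x xs r≤xs)

      shift-increasing : ∀ {l} → AllPairs _<_ l → AllPairs _<_ (map (_+ N) l)
      shift-increasing l↑ = AllPairs.map⁺ (AllPairs.map (+-monoˡ-< N) l↑)

      full-compatible : ∀ l → AllPairs _<_ l → All (r ≤_) l → Defined (full ∙ ∏ (⟦_⟧ ∘ g) l)
      full-compatible []       _  _   = full∙ε↓
      full-compatible (h ∷ hs) l↑ r≤l
        with p , prod≡p , (compatible ∷ []) ← proj₂ (f-tails (value full List⁺.∷ [])) (h + N) (map (_+ N) hs) (shift-increasing l↑) (m≤n+m N h) =
        subst (λ y → Defined (full ∙ y)) ⟦p⟧≡ (Defined-∙⟦⟧ full full↓ compatible)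
        where
        ⟦p⟧≡ : ⟦ p ⟧ ≡ ∏ (⟦_⟧ ∘ g) (h ∷ hs)
        ⟦p⟧≡ = begin
          ⟦ p ⟧                                    ≡⟨ cong just prod≡p ⟨
          just (prod f (h + N) (map (_+ N) hs))    ≡⟨ cong just (prod-g-high h hs r≤l) ⟨
          just (prod g h hs)                       ≡⟨ prod-∏ g h hs ⟩
          ∏ (⟦_⟧ ∘ g) (h ∷ hs)                     ∎
          where open ≡-Reasoning

      g-products : ∀ h hs → AllPairs _<_ (h ∷ hs) → Is-just (prod g h hs)
      g-products h hs l↑ = subst Defined (sym (trans (prod-∏ g h hs) split)) low∙high↓
        where
        l low high : List ℕ
        l = h ∷ hs
        low = filter (_<? r) l
        high = filter (∁? (_<? r)) l
        split : ∏ (⟦_⟧ ∘ g) l ≡ ∏ fc low ∙ ∏ (⟦_⟧ ∘ g) high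
        split = trans (∏-partition (⟦_⟧ ∘ g) (_<? r) l)
                      (cong (_∙ ∏ (⟦_⟧ ∘ g) high) (∏-cong (All.map g-low (All.all-filter (_<? r) l))))
        low∙high↓ : Defined (∏ fc low ∙ ∏ (⟦_⟧ ∘ g) high)
        low∙high↓ = Defined-∏-increasing fc _ (AllPairs.filter⁺ (_<? r) l↑) (All.all-filter (_<? r) l)
          (full-compatible high (AllPairs.filter⁺ (∁? (_<? r)) l↑) (All.map ≮⇒≥ (All.all-filter (∁? (_<? r)) l)))

      g-tails : (E : List⁺ Carrier) → Σ ℕ λ m → ∀ h hs → AllPairs _<_ (h ∷ hs) → m ≤ h → DefinedIn (σ E) (prod g h hs)
      g-tails E with m , f-tail ← f-tails E = r + m , g-tail
        where
        g-tail : ∀ h hs → AllPairs _<_ (h ∷ hs) → r + m ≤ h → DefinedIn (σ E) (prod g h hs)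
        g-tail h hs l↑@(h<hs ∷ _) r+m≤h =
          subst (DefinedIn (σ E)) (sym (prod-g-high h hs (r≤h ∷ All.map (λ h<y → ≤-trans r≤h (<⇒≤ h<y)) h<hs)))
            (f-tail (h + N) (map (_+ N) hs) (shift-increasing l↑) (≤-trans (m≤n+m m r) (≤-trans r+m≤h (m≤m+n h N))))
          where
          r≤h : r ≤ h
          r≤h = ≤-trans (m≤m+n r m) r+m≤h

    -- Returns f unchanged when its prefix product with c is undefined; that case is never used.
    absorbPrefix : (c : ℕ → Carrier) (r : ℕ) → AdequateSeq → AdequateSeq
    absorbPrefix c r (f , f-adequate) with Defined? (∏ (λ i → ⟦ f i ⟧ ∙ ⟦ c i ⟧) (downFrom r))
    ... | yes full↓ = let g , g-adequate , _ = adequate-prefix-product f-adequate c r full↓ in g , g-adequate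
    ... | no _      = f , f-adequate

    absorbPrefix-low : ∀ c r f → Defined (∏ (λ i → ⟦ proj₁ f i ⟧ ∙ ⟦ c i ⟧) (downFrom r)) →
      ∀ {i} → i < r → ⟦ proj₁ (absorbPrefix c r f) i ⟧ ≡ ⟦ proj₁ f i ⟧ ∙ ⟦ c i ⟧
    absorbPrefix-low c r (f , f-adequate) full↓ with Defined? (∏ (λ i → ⟦ f i ⟧ ∙ ⟦ c i ⟧) (downFrom r))
    ... | yes full↓′ = proj₂ (proj₂ (adequate-prefix-product f-adequate c r full↓′))
    ... | no ¬full↓  = contradiction full↓ ¬full↓

    interleaved⇒prefixed : ∀ {X r F} → InterleavedProductsIn X r F → PrefixedProductsIn X r F
    interleaved⇒prefixed {X} {r} {f₀ List⁺.∷ _} (suc m , _ , a , t , t↑ , t<r , F↓@((_ , f₀≡ , _) ∷ _)) =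
      value as , t Fin.zero , tabulate (t ∘ Fin.suc) ,
      AllPairs.tabulate⁺-< (t↑ _ _) , All.tabulate⁺ t<r , All.map (subst (DefinedIn X) (interleave≡ _)) F↓
      where
      as : S¹
      as = ⟦ a Fin.zero ⟧ ∙ ∏ (⟦_⟧ ∘ a ∘ Fin.suc) (allFin (suc m))

      as≡ : as ≡ ⟦ value as ⟧
      as≡ = ⟦⟧∙-value (a Fin.zero) (∏ (⟦_⟧ ∘ a ∘ Fin.suc) (allFin (suc m)))
        (Defined-∙ˡ as (subst Defined (trans (sym (cong just f₀≡)) (interleave-split (proj₁ f₀) (suc m) a t)) (is-just tt)))

      interleave≡ : ∀ f → interleave f (suc m) a t ≡ just (value as) ⊛ prod f (t Fin.zero) (tabulate (t ∘ Fin.suc))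
      interleave≡ f = just-injective (begin
        just (interleave f (suc m) a t)                               ≡⟨ interleave-split f (suc m) a t ⟩
        as ∙ ∏ (⟦_⟧ ∘ f) (tabulate t)                                 ≡⟨ cong₂ _∙_ as≡ (sym (prod-∏ f (t Fin.zero) (tabulate (t ∘ Fin.suc)))) ⟩
        ⟦ value as ⟧ ∙ just (prod f (t Fin.zero) (tabulate (t ∘ Fin.suc))) ∎)
        where open ≡-Reasoning

    prefixed⇒interleaved : Adequate → ∀ {X r k} → (∀ F → length (toList F) ≤ k → PrefixedProductsIn X r F) →
      ∀ F → length (toList F) ≤ k → InterleavedProductsIn X r F
    prefixed⇒interleaved ad {X} {r} {k} prefixed F len≤k
      with c , c-compatible ← adequate-complement ad (List⁺.map (λ f → ∏ (⟦_⟧ ∘ proj₁ f) (downFrom r)) F)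
                                (All.map⁺ (All.universal (λ f → adequate-∏-downFrom (proj₂ f) r) (toList F)))
      with b , h , hs , H↑ , H<r , F′↓ ← prefixed (List⁺.map (absorbPrefix c r) F)
                                           (subst (_≤ k) (sym (length-map (absorbPrefix c r) (toList F))) len≤k) =
      length H , s≤s z≤n , b Vector.∷ (c ∘ lookup H) , lookup H ,
      (λ _ _ → lookup-increasing H↑) , (λ i → All.lookup H<r (∈-lookup i)) ,
      All.zipWith transfer (full↓ , All.map⁻ F′↓)
      where
      H : List ℕ
      H = h ∷ hs

      fc : AdequateSeq → ℕ → S¹
      fc f i = ⟦ proj₁ f i ⟧ ∙ ⟦ c i ⟧

      full↓ : All (λ f → Defined (∏ (fc f) (downFrom r))) (toList F)
      full↓ = All.map (λ {f} → subst Defined (sym (∏-∙ (⟦_⟧ ∘ proj₁ f) (⟦_⟧ ∘ c) (downFrom r))))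
                      (All.map⁻ (c-compatible r))

      transfer : ∀ {f} → Defined (∏ (fc f) (downFrom r)) × DefinedIn X (just b ⊛ prod (proj₁ (absorbPrefix c r f)) h hs) →
        DefinedIn X (interleave (proj₁ f) (length H) (b Vector.∷ (c ∘ lookup H)) (lookup H))
      transfer {f} (f-full↓ , g↓) = subst (DefinedIn X) (just-injective (sym interleave≡)) g↓
        where
        g : ℕ → Carrier
        g = proj₁ (absorbPrefix c r f)
        interleave≡ : just (interleave (proj₁ f) (length H) (b Vector.∷ (c ∘ lookup H)) (lookup H)) ≡ ⟦ b ⟧ ∙ just (prod g h hs)
        interleave≡ = begin
          just (interleave (proj₁ f) (length H) (b Vector.∷ (c ∘ lookup H)) (lookup H)) ≡⟨ interleave-lookup (proj₁ f) b c H ⟩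
          ⟦ b ⟧ ∙ ∏ (fc f) H             ≡⟨ cong (⟦ b ⟧ ∙_) (∏-cong (All.map (λ i<r → sym (absorbPrefix-low c r f f-full↓ i<r)) H<r)) ⟩
          ⟦ b ⟧ ∙ ∏ (⟦_⟧ ∘ g) H          ≡⟨ cong (⟦ b ⟧ ∙_) (prod-∏ g h hs) ⟨
          ⟦ b ⟧ ∙ just (prod g h hs)     ∎
          where open ≡-Reasoning

theorem5p3 : (P : PartialSemigroup) → let open PS P in
    Commutative → Adequate → (A : Carrier → Set) → (k : ℕ) →
    ((L : List⁺ Carrier) → Σ ℕ λ r → (F : List⁺ AdequateSeq) → length (toList F) ≤ k →
       Σ Carrier λ b → Σ ℕ λ h → Σ (List ℕ) λ hs → AllPairs _<_ (h ∷ hs) × All (_< r) (h ∷ hs) ×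
         All (λ f → DefinedIn (λ c → A c × σ L c) (just b ⊛ prod (proj₁ f) h hs)) (toList F))
    ⇔
    ((L : List⁺ Carrier) → Σ ℕ λ r → (F : List⁺ AdequateSeq) → length (toList F) ≤ k →
       Σ ℕ λ m → 1 ≤ m × Σ (Fin (suc m) → Carrier) λ a → Σ (Fin m → ℕ) λ t →
         ((i j : Fin m) → i Fin.< j → t i < t j) × ((i : Fin m) → t i < r) ×
         All (λ f → DefinedIn (λ c → A c × σ L c) (interleave (proj₁ f) m a t)) (toList F))
theorem5p3 P comm ad A k = mk⇔
  (λ hyp₁ L → proj₁ (hyp₁ L) , prefixed⇒interleaved P comm ad (proj₂ (hyp₁ L)))
  (λ hyp₂ L → proj₁ (hyp₂ L) , λ F len≤k → interleaved⇒prefixed P comm (proj₂ (hyp₂ L) F len≤k))
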